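{- Let $k\ge 3$, let $(G,\mathcal{X})$ be a $k$-ordered graph and let $(V,\preceq)$ be the partial order generated by $\mathcal{X}$. Then for any nonempty antichain $L=\{v_1,\dots,v_m\}$ of $(V,\preceq)$, there exist a forward-directed subtree $S$ and a backward-directed subtree $T$ of $G$ with $L(S)=L(T)=L$.
   Context: Let $G$ be a graph on $n$ vertices and $\mathcal{X}=x_1,\dots,x_n$ an ordering of $V=V(G)$. Write $N^+(x_i)=\{x_j\in N_G(x_i):j>i\}$, $d^+(x_i)=|N^+(x_i)|$ and $d^-(x_i)=|\{x_j\in N_G(x_i):j<i\}|$. The pair $(G,\mathcal{X})$ is a $k$-ordered graph if (1) $x_{n-1}x_n\in E(G)$; (2) $d^+(x_i)\in[2,k]$ for all $1\le i\le n-2$; and (3) $d^-(x_i)\ge 1$ for all $2\le i\le n$. A path $w_1\cdots w_t$ is a forward $(w_1,w_t)$-path if $w_{i+1}\in N^+(w_i)$ for every $i\in[t-1]$ (a single vertex is also a forward path). The partial order generated by $\mathcal{X}$ is defined by $u\preceq v$ iff there is a forward $(u,v)$-path in $G$. For a tree $T$, $L(T)$ is its set of leaves (vertices of degree $1$ in $T$; a one-vertex tree has its unique vertex as its leaf). A subtree $T$ of $G$ rooted at $u$ is forward-directed (resp. backward-directed) if (1) for every path $u_1u_2\cdots u_t$ in $T$ with $u_1=u$ and $u_t\in L(T)$ we have $u_i\preceq u_{i+1}$ (resp. $u_{i+1}\preceq u_i$) for all $i\in[t-1]$, and (2) either $d_T(u)\ge 2$ or $T$ consists of a single vertex. -}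

module Defs where

open import Data.Nat using (ℕ; zero; suc; _+_; _≤_; _<_; _<ᵇ_)
open import Data.Fin using (Fin; toℕ)
open import Data.Fin.Subset using (Subset; _∈_) public
open import Data.Bool using (Bool; true; false; _∧_)
open import Data.List using (List; []; _∷_; length; filterᵇ; allFin)
open import Data.List.Relation.Unary.Unique.Propositional using (Unique)
open import Data.List.Relation.Unary.Linked using (Linked)
open import Data.Product using (Σ; _×_; ∃; ∃₂)
open import Data.Sum using (_⊎_)
open import Data.Empty using (⊥)
open import Relation.Binary.PropositionalEquality using (_≡_)

-- A simple graph on the vertex set Fin n.  The ordering 𝒳 = x₁,…,xₙ is
-- identified with the natural order of Fin n (x_i is the vertex with toℕ = i - 1).
record SimpleGraph (n : ℕ) : Set where
  field
    adj    : Fin n → Fin n → Bool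
    sym    : ∀ i j → adj i j ≡ adj j i
    irrefl : ∀ i → adj i i ≡ false
open SimpleGraph public

module _ {n : ℕ} (G : SimpleGraph n) where

  outdeg : Fin n → ℕ
  outdeg i = length (filterᵇ (λ j → (toℕ i <ᵇ toℕ j) ∧ adj G i j) (allFin n))

  indeg : Fin n → ℕ
  indeg i = length (filterᵇ (λ j → (toℕ j <ᵇ toℕ i) ∧ adj G i j) (allFin n))

  record KOrdered (k : ℕ) : Set where
    field
      lastEdge : ∃₂ λ a b → (suc (suc (toℕ a)) ≡ n) × (suc (toℕ b) ≡ n) × (adj G a b ≡ true)
      outdegBounds : ∀ i → suc (suc (toℕ i)) < n → (2 ≤ outdeg i) × (outdeg i ≤ k)
      indegPos : ∀ i → 1 ≤ toℕ i → 1 ≤ indeg i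

  data ForwardPath : Fin n → Fin n → Set where
    single : ∀ u → ForwardPath u u
    step   : ∀ {u w v} → adj G u w ≡ true → toℕ u < toℕ w → ForwardPath w v → ForwardPath u v

  _⪯_ : Fin n → Fin n → Set
  u ⪯ v = ForwardPath u v

  IsAntichain : Subset n → Set
  IsAntichain L = ∀ u v → u ∈ L → v ∈ L → u ⪯ v → u ≡ v

  record Subgraph : Set where
    field
      verts    : Subset n
      edge     : Fin n → Fin n → Bool
      edgeSym  : ∀ i j → edge i j ≡ edge j i
      edgeSub  : ∀ i j → edge i j ≡ true → adj G i j ≡ true
      edgeVert : ∀ i j → edge i j ≡ true → i ∈ verts × j ∈ verts

module _ {n : ℕ} {G : SimpleGraph n} (H : Subgraph G) where
  open Subgraph H

  data Walk : Fin n → Fin n → List (Fin n) → Set where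
    here : ∀ {u} → u ∈ verts → Walk u u (u ∷ [])
    step : ∀ {u w v ws} → edge u w ≡ true → Walk w v ws → Walk u v (u ∷ ws)

  IsPath : Fin n → Fin n → List (Fin n) → Set
  IsPath u v ws = Walk u v ws × Unique ws

  Connected : Set
  Connected = ∀ u v → u ∈ verts → v ∈ verts → ∃ λ ws → Walk u v ws

  HasCycle : Set
  HasCycle = Σ (Fin n) λ u → Σ (Fin n) λ v → Σ (List (Fin n)) λ ws →
               IsPath u v ws × (3 ≤ length ws) × (edge v u ≡ true)

  record IsTree : Set where
    field
      nonempty  : ∃ λ u → u ∈ verts
      connected : Connected
      acyclic   : HasCycle → ⊥

  degT : Fin n → ℕ
  degT u = length (filterᵇ (edge u) (allFin n))

  IsLeaf : Fin n → Set
  IsLeaf v = v ∈ verts × ((degT v ≡ 1) ⊎ (∀ w → w ∈ verts → w ≡ v))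

record Subtree {n : ℕ} (G : SimpleGraph n) : Set where
  field
    graph  : Subgraph G
    isTree : IsTree graph
open Subtree public

module _ {n : ℕ} {G : SimpleGraph n} (T : Subtree G) where
  private H = graph T
  open Subgraph H

  RootCondition : Fin n → Set
  RootCondition u = (2 ≤ degT H u) ⊎ (∀ w → w ∈ verts → w ≡ u)

  ForwardDirected : Fin n → Set
  ForwardDirected u = u ∈ verts ×
    (∀ ℓ ws → IsLeaf H ℓ → IsPath H u ℓ ws → Linked (_⪯_ G) ws) × RootCondition u

  BackwardDirected : Fin n → Set
  BackwardDirected u = u ∈ verts ×
    (∀ ℓ ws → IsLeaf H ℓ → IsPath H u ℓ ws → Linked (λ a b → _⪯_ G b a) ws) × RootCondition u

  LeavesEq : Subset n → Set
  LeavesEq L = ∀ v → (IsLeaf H v → v ∈ L) × (v ∈ L → IsLeaf H v)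

{-# OPTIONS --safe #-}
module Submission where

-- Every vertex except x₁ has an earlier neighbour (d⁻ ≥ 1); choosing one as its parent gives a
-- spanning tree rooted at x₁ whose parent-to-child edges are forward steps.  Let u be a lowest
-- common ancestor of L in this tree and take the union of the tree paths from u to the vertices of L.
-- As L is an antichain no vertex of L lies below another, so the leaves are exactly the vertices of
-- L, and u branches unless L = {u}; every path from u runs down the tree, hence forward.  Dually,
-- every vertex except xₙ has a later neighbour (d⁺ ≥ 2 before x_{n-1}, and the edge x_{n-1}xₙ),
-- which gives the backward-directed tree.

open import Defs hiding (sym)
open import Level using (0ℓ)
open import Function using (_∘_; mk⇔; Equivalence)
open import Data.Nat using (ℕ; zero; suc; _≤_; _<_; _∸_; _<ᵇ_; _<?_; z≤n; s≤s)
open import Data.Nat.Properties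
  using ( <-irrefl; <-asym; <-trans; <⇒≤; <⇒≱; ≤-refl; ≤-trans; ≤-antisym; ≤-reflexive; ≤∧≢⇒<; ≮⇒≥
        ; <ᵇ⇒<; suc-injective; ∸-monoʳ-<)
open import Data.Nat.Induction using (<-wellFounded)
open import Induction.WellFounded using (Acc; acc)
open import Data.Fin using (Fin; toℕ; zero; suc)
open import Data.Fin.Properties using (_≟_; any?; all?; ¬∀⟶∃¬; toℕ-injective; toℕ<n)
open import Data.Fin.Subset using (Subset; Nonempty)
open import Data.Fin.Subset.Properties using (_∈?_)
open import Data.Bool using (Bool; true; T; _∧_)
open import Data.Bool.Properties using (T-≡; T-∧)
open import Data.Vec using (tabulate)
open import Data.Vec.Properties using (lookup∘tabulate; []=⇒lookup; lookup⇒[]=)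
open import Data.List using (List; []; _∷_; _++_; [_]; length; reverse; filterᵇ; allFin)
open import Data.List.Properties using (unfold-reverse; length-reverse)
open import Data.List.Membership.Propositional using () renaming (_∈_ to _∈ₗ_)
open import Data.List.Membership.Propositional.Properties using (∈-filter⁺; ∈-filter⁻; ∈-allFin)
open import Data.List.Relation.Unary.Any using (here; there)
open import Data.List.Relation.Unary.All using (_∷_)
open import Data.List.Relation.Unary.AllPairs using (_∷_)
open import Data.List.Relation.Unary.Unique.Propositional using (Unique)
open import Data.List.Relation.Unary.Unique.Propositional.Properties
  using (filter⁺; allFin⁺; Unique[x∷xs]⇒x∉xs)
open import Data.List.Relation.Unary.Linked as Linked using (Linked; [-]; _∷_)
open import Data.List.Relation.Binary.Permutation.Setoid using (↭-sym)
open import Data.List.Relation.Binary.Permutation.Setoid.Properties using (Unique-resp-↭; ↭-reverse)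
open import Data.Product using (Σ; ∃; _×_; _,_; proj₁; proj₂)
open import Data.Sum using (_⊎_; inj₁; inj₂; [_,_]′; swap)
open import Relation.Nullary using (¬_; Dec; yes; no; does; ¬?; contradiction)
open import Relation.Nullary.Decidable using (T?; dec-true; does-⇔; _×-dec_; _⊎-dec_; _→-dec_)
open import Relation.Unary using (Pred; Decidable)
open import Relation.Binary using (Rel; Reflexive; Transitive)
open import Relation.Binary.PropositionalEquality using (_≡_; _≢_; refl; sym; trans; subst; setoid)

module _ {A : Set} where

  nonempty⇒∈ : {xs : List A} → 1 ≤ length xs → ∃ (_∈ₗ xs)
  nonempty⇒∈ {x ∷ _} _ = x , here refl

  ∈∧∈∧≢⇒2≤length : {xs : List A} {a b : A} → a ∈ₗ xs → b ∈ₗ xs → a ≢ b → 2 ≤ length xs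
  ∈∧∈∧≢⇒2≤length {_ ∷ []}    (here refl) (here refl) a≢b = contradiction refl a≢b
  ∈∧∈∧≢⇒2≤length {_ ∷ _ ∷ _} _           _           _   = s≤s (s≤s z≤n)

  unique∧all≡⇒length≡1 : {xs : List A} {c : A} → Unique xs → c ∈ₗ xs → (∀ y → y ∈ₗ xs → y ≡ c) →
                         length xs ≡ 1
  unique∧all≡⇒length≡1 {_ ∷ []}    _               _ _    = refl
  unique∧all≡⇒length≡1 {x ∷ y ∷ _} ((x≢y ∷ _) ∷ _) _ only =
    contradiction (trans (only x (here refl)) (sym (only y (there (here refl))))) x≢y

  unique-reverse : {xs : List A} → Unique xs → Unique (reverse xs)
  unique-reverse {xs} = Unique-resp-↭ (setoid A) (↭-sym (setoid A) (↭-reverse (setoid A) xs))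

  filterᵇ-witness : (f : A → Bool) (xs : List A) → 1 ≤ length (filterᵇ f xs) → ∃ λ x → T (f x)
  filterᵇ-witness f xs nonempty with nonempty⇒∈ {filterᵇ f xs} nonempty
  ... | x , x∈ = x , proj₂ (∈-filter⁻ (T? ∘ f) {xs = xs} x∈)

does-true⇒ : {A : Set} (a? : Dec A) → does a? ≡ true → A
does-true⇒ (yes a) _ = a

module _ {n : ℕ} {P : Pred (Fin n) 0ℓ} (P? : Decidable P) where

  toSubset : Subset n
  toSubset = tabulate (does ∘ P?)

  ∈-toSubset⁺ : ∀ {x} → P x → x ∈ toSubset
  ∈-toSubset⁺ {x} p = lookup⇒[]= x _ (trans (lookup∘tabulate (does ∘ P?) x) (dec-true (P? x) p))

  ∈-toSubset⁻ : ∀ {x} → x ∈ toSubset → P x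
  ∈-toSubset⁻ {x} x∈ = does-true⇒ (P? x) (trans (sym (lookup∘tabulate (does ∘ P?) x)) ([]=⇒lookup x∈))

module Walks {n : ℕ} {G : SimpleGraph n} (H : Subgraph G) where
  open Subgraph H

  walk-start∈ : ∀ {a v ws} → Walk H a v ws → a ∈ₗ ws
  walk-start∈ (here _)   = here refl
  walk-start∈ (step _ _) = here refl

  walk-end∈ : ∀ {a v ws} → Walk H a v ws → v ∈ₗ ws
  walk-end∈ (here _)   = here refl
  walk-end∈ (step _ w) = there (walk-end∈ w)

  walk-snoc : ∀ {a v z ws} → Walk H a v ws → edge v z ≡ true → Walk H a z (ws ++ [ z ])
  walk-snoc (here _)    vz = step vz (here (proj₂ (edgeVert _ _ vz)))
  walk-snoc (step e w) vz = step e (walk-snoc w vz)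

  walk-reverse : ∀ {a v ws} → Walk H a v ws → Walk H v a (reverse ws)
  walk-reverse (here a∈) = here a∈
  walk-reverse (step {u} {w} {v} {ws} uw walk) =
    subst (Walk H v u) (sym (unfold-reverse u ws)) (walk-snoc (walk-reverse walk) (trans (edgeSym w u) uw))

  walk-join : ∀ {a m b ws vs} → Walk H a m ws → Walk H m b vs → ∃ (Walk H a b)
  walk-join (here _)   w₂ = _ , w₂
  walk-join (step e w₁) w₂ = _ , step e (proj₂ (walk-join w₁ w₂))

  neighbour∈ : ∀ {v a} → edge v a ≡ true → a ∈ₗ filterᵇ (edge v) (allFin n)
  neighbour∈ {v} {a} va = ∈-filter⁺ (T? ∘ edge v) (∈-allFin a) (Equivalence.from T-≡ va)

  2≤degT : ∀ {v a b} → edge v a ≡ true → edge v b ≡ true → a ≢ b → 2 ≤ degT H v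
  2≤degT va vb = ∈∧∈∧≢⇒2≤length (neighbour∈ va) (neighbour∈ vb)

  degT≡1 : ∀ {v c} → edge v c ≡ true → (∀ y → edge v y ≡ true → y ≡ c) → degT H v ≡ 1
  degT≡1 {v} vc only = unique∧all≡⇒length≡1 (filter⁺ (T? ∘ edge v) (allFin⁺ n)) (neighbour∈ vc)
    (λ y y∈ → only y (Equivalence.to T-≡ (proj₂ (∈-filter⁻ (T? ∘ edge v) {xs = allFin n} y∈))))

Antichain : ∀ {n} → Rel (Fin n) 0ℓ → Subset n → Set
Antichain R L = ∀ v w → v ∈ L → w ∈ L → R v w → v ≡ w

-- ForwardDirected and BackwardDirected are Directed (_⪯_ G) and Directed (flip (_⪯_ G)).
Directed : ∀ {n} {G : SimpleGraph n} → Rel (Fin n) 0ℓ → Subtree G → Fin n → Set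
Directed R T u = u ∈ Subgraph.verts (graph T) ×
  (∀ ℓ ws → IsLeaf (graph T) ℓ → IsPath (graph T) u ℓ ws → Linked R ws) × RootCondition T u

module Arborescence {n : ℕ} (G : SimpleGraph n) {R : Rel (Fin n) 0ℓ}
  (R-refl : Reflexive R) (R-trans : Transitive R) (rank : Fin n → ℕ) (root : Fin n)
  (predecessor : ∀ y → y ≢ root → ∃ λ x → adj G y x ≡ true × rank x < rank y × R x y)
  where

  -- parent root is a junk value (root itself); every use of parent y comes with y ≢ root.
  parent-spec : ∀ y → Σ (Fin n) λ x → y ≢ root → adj G y x ≡ true × rank x < rank y × R x y
  parent-spec y with y ≟ root
  ... | yes y≡root = y , contradiction y≡root
  ... | no y≢root  = proj₁ (predecessor y y≢root) , λ _ → proj₂ (predecessor y y≢root)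

  parent : Fin n → Fin n
  parent y = proj₁ (parent-spec y)

  parent-adj : ∀ {y} → y ≢ root → adj G (parent y) y ≡ true
  parent-adj {y} y≢root = trans (SimpleGraph.sym G (parent y) y) (proj₁ (proj₂ (parent-spec y) y≢root))

  parent-rank : ∀ {y} → y ≢ root → rank (parent y) < rank y
  parent-rank {y} y≢root = proj₁ (proj₂ (proj₂ (parent-spec y) y≢root))

  parent-R : ∀ {y} → y ≢ root → R (parent y) y
  parent-R {y} y≢root = proj₂ (proj₂ (proj₂ (parent-spec y) y≢root))

  infix 4 _≼_
  data _≼_ : Fin n → Fin n → Set where
    self : ∀ {x} → x ≼ x
    up   : ∀ {x y} → y ≢ root → x ≼ parent y → x ≼ y

  parent≼ : ∀ {y} → y ≢ root → parent y ≼ y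
  parent≼ y≢root = up y≢root self

  ≼-trans : Transitive _≼_
  ≼-trans x≼y self         = x≼y
  ≼-trans x≼y (up ne y≼pz) = up ne (≼-trans x≼y y≼pz)

  ≼⇒R : ∀ {x y} → x ≼ y → R x y
  ≼⇒R self             = R-refl
  ≼⇒R (up y≢root x≼py) = R-trans (≼⇒R x≼py) (parent-R y≢root)

  ≼⇒rank≤ : ∀ {x y} → x ≼ y → rank x ≤ rank y
  ≼⇒rank≤ self             = ≤-refl
  ≼⇒rank≤ (up y≢root x≼py) = ≤-trans (≼⇒rank≤ x≼py) (<⇒≤ (parent-rank y≢root))

  child⋠parent : ∀ {y} → y ≢ root → ¬ y ≼ parent y
  child⋠parent y≢root y≼py = <⇒≱ (parent-rank y≢root) (≼⇒rank≤ y≼py)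

  ≼-antisym : ∀ {x y} → x ≼ y → y ≼ x → x ≡ y
  ≼-antisym self             _   = refl
  ≼-antisym (up y≢root x≼py) y≼x = contradiction (≼-trans y≼x x≼py) (child⋠parent y≢root)

  ≼-up-inv : ∀ {x y} → x ≼ y → x ≢ y → y ≢ root × x ≼ parent y
  ≼-up-inv self             x≢x = contradiction refl x≢x
  ≼-up-inv (up y≢root x≼py) _   = y≢root , x≼py

  ≼-child : ∀ {x w} → x ≼ w → x ≢ w → ∃ λ c → c ≢ root × parent c ≡ x × c ≼ w
  ≼-child self x≢x = contradiction refl x≢x
  ≼-child {x} (up {y = w} w≢root x≼pw) _ with x ≟ parent w
  ... | yes refl = w , w≢root , refl , self
  ... | no x≢pw with ≼-child x≼pw x≢pw
  ...   | c , c≢root , pc≡x , c≼pw = c , c≢root , pc≡x , up w≢root c≼pw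

  ≼-linear-below : ∀ {x y v} → x ≼ v → y ≼ v → x ≼ y ⊎ y ≼ x
  ≼-linear-below x≼v          self         = inj₁ x≼v
  ≼-linear-below self         (up ne y≼pv) = inj₂ (up ne y≼pv)
  ≼-linear-below (up _ x≼pv) (up _ y≼pv)  = ≼-linear-below x≼pv y≼pv

  sibling≼⇒≡ : ∀ {x y} → x ≢ root → parent x ≡ parent y → x ≼ y → x ≡ y
  sibling≼⇒≡ _      _     self        = refl
  sibling≼⇒≡ x≢root px≡py (up _ x≼py) =
    contradiction (subst (_ ≼_) (sym px≡py) x≼py) (child⋠parent x≢root)

  siblings-below-≡ : ∀ {x y v} → x ≢ root → y ≢ root → parent x ≡ parent y → x ≼ v → y ≼ v → x ≡ y
  siblings-below-≡ x≢root y≢root px≡py x≼v y≼v with ≼-linear-below x≼v y≼v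
  ... | inj₁ x≼y = sibling≼⇒≡ x≢root px≡py x≼y
  ... | inj₂ y≼x = sym (sibling≼⇒≡ y≢root (sym px≡py) y≼x)

  root≼ : ∀ y → root ≼ y
  root≼ y = from-acc y (<-wellFounded (rank y))
    where
      from-acc : ∀ y → Acc _<_ (rank y) → root ≼ y
      from-acc y (acc below) with y ≟ root
      ... | yes refl  = self
      ... | no y≢root = up y≢root (from-acc (parent y) (below (parent-rank y≢root)))

  infix 4 _≼?_
  _≼?_ : ∀ x y → Dec (x ≼ y)
  x ≼? y = along (root≼ y)
    where
      along : ∀ {y} → root ≼ y → Dec (x ≼ y)
      along {y} _ with x ≟ y
      along         _                | yes refl = yes self
      along         self             | no x≢root = no λ { self → x≢root refl ; (up r≢r _) → r≢r refl }
      along         (up y≢root r≼py) | no x≢y with along r≼py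
      ... | yes x≼py = yes (up y≢root x≼py)
      ... | no x⋠py  = no λ { self → x≢y refl ; (up _ x≼py) → x⋠py x≼py }

  module _ (L : Subset n) where

    CommonAncestor : Pred (Fin n) 0ℓ
    CommonAncestor x = ∀ w → w ∈ L → x ≼ w

    CommonAncestor? : Decidable CommonAncestor
    CommonAncestor? x = all? λ w → w ∈? L →-dec x ≼? w

    ¬CommonAncestor⇒∃ : ∀ {x} → ¬ CommonAncestor x → ∃ λ w → w ∈ L × ¬ x ≼ w
    ¬CommonAncestor⇒∃ {x} ¬common with ¬∀⟶∃¬ n _ (λ w → w ∈? L →-dec x ≼? w) ¬common
    ... | w , ¬[w∈L→x≼w] with w ∈? L
    ...   | yes w∈L = w , w∈L , λ x≼w → ¬[w∈L→x≼w] λ _ → x≼w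
    ...   | no  w∉L = contradiction (λ w∈L → contradiction w∈L w∉L) ¬[w∈L→x≼w]

    LowestCommonAncestor : Pred (Fin n) 0ℓ
    LowestCommonAncestor u = CommonAncestor u × (∀ c → c ≢ root → parent c ≡ u → ¬ CommonAncestor c)

    lowest-common-ancestor : Nonempty L → ∃ LowestCommonAncestor
    lowest-common-ancestor (v , v∈L) with CommonAncestor? v
    ... | yes common = v , common , λ c c≢root pc≡v common-c →
            child⋠parent c≢root (subst (c ≼_) (sym pc≡v) (common-c v v∈L))
    ... | no ¬common = climb (root≼ v) self ¬common
      where
        -- The first common ancestor met climbing from v is lowest: another child of it that is a
        -- common ancestor would, like y, lie below v, hence be y.
        climb : ∀ {y} → root ≼ y → y ≼ v → ¬ CommonAncestor y → ∃ LowestCommonAncestor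
        climb self             _   ¬common-y = contradiction (λ w _ → root≼ w) ¬common-y
        climb (up {y = y} y≢root r≼py) y≼v ¬common-y with CommonAncestor? (parent y)
        ... | yes common = parent y , common , λ c c≢root pc≡py common-c →
                ¬common-y (subst CommonAncestor
                  (siblings-below-≡ c≢root y≢root pc≡py (common-c v v∈L) y≼v) common-c)
        ... | no ¬common-py = climb r≼py (≼-trans (parent≼ y≢root) y≼v) ¬common-py

  module SteinerTree (L : Subset n) (L-antichain : Antichain R L) {v₀ : Fin n} (v₀∈L : v₀ ∈ L)
    {u : Fin n} (u-lca : LowestCommonAncestor L u) where

    u-common : CommonAncestor L u
    u-common = proj₁ u-lca

    L-≼⇒≡ : ∀ {v w} → v ∈ L → w ∈ L → v ≼ w → v ≡ w
    L-≼⇒≡ v∈L w∈L v≼w = L-antichain _ _ v∈L w∈L (≼⇒R v≼w)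

    ∉L⇒≢ : ∀ {x w} → ¬ x ∈ L → w ∈ L → x ≢ w
    ∉L⇒≢ x∉L w∈L refl = x∉L w∈L

    InTree : Pred (Fin n) 0ℓ
    InTree x = u ≼ x × ∃ λ w → w ∈ L × x ≼ w

    InTree? : Decidable InTree
    InTree? x = u ≼? x ×-dec any? λ w → w ∈? L ×-dec x ≼? w

    u-in-tree : InTree u
    u-in-tree = self , v₀ , v₀∈L , u-common v₀ v₀∈L

    infix 4 _⋖_
    _⋖_ : Rel (Fin n) 0ℓ
    a ⋖ b = InTree b × b ≢ u × parent b ≡ a

    _⋖?_ : ∀ a b → Dec (a ⋖ b)
    a ⋖? b = InTree? b ×-dec ¬? (b ≟ u) ×-dec parent b ≟ a

    ⋖⇒≢root : ∀ {a b} → a ⋖ b → b ≢ root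
    ⋖⇒≢root ((u≼b , _) , b≢u , _) = proj₁ (≼-up-inv u≼b (b≢u ∘ sym))

    ⋖-rank : ∀ {a b} → a ⋖ b → rank a < rank b
    ⋖-rank a⋖b@(_ , _ , refl) = parent-rank (⋖⇒≢root a⋖b)

    ⋖⇒R : ∀ {a b} → a ⋖ b → R a b
    ⋖⇒R a⋖b@(_ , _ , refl) = parent-R (⋖⇒≢root a⋖b)

    ⋖-adj : ∀ {a b} → a ⋖ b → adj G a b ≡ true
    ⋖-adj a⋖b@(_ , _ , refl) = parent-adj (⋖⇒≢root a⋖b)

    ⋖-irrefl : ∀ {a} → ¬ a ⋖ a
    ⋖-irrefl a⋖a = <-irrefl refl (⋖-rank a⋖a)

    ⋖-chain-≢ : ∀ {a b c} → a ⋖ b → b ⋖ c → a ≢ c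
    ⋖-chain-≢ a⋖b b⋖c refl = <-asym (⋖-rank a⋖b) (⋖-rank b⋖c)

    ⋖-parent-unique : ∀ {a b c} → a ⋖ b → c ⋖ b → a ≡ c
    ⋖-parent-unique (_ , _ , refl) (_ , _ , refl) = refl

    ⋖-source-in-tree : ∀ {a b} → a ⋖ b → InTree a
    ⋖-source-in-tree a⋖b@((u≼b , w , w∈L , b≼w) , b≢u , refl) =
      proj₂ (≼-up-inv u≼b (b≢u ∘ sym)) , w , w∈L , ≼-trans (parent≼ (⋖⇒≢root a⋖b)) b≼w

    parent-⋖ : ∀ {x} → InTree x → x ≢ u → parent x ⋖ x
    parent-⋖ x-in x≢u = x-in , x≢u , refl

    child-toward : ∀ {x w} → InTree x → x ≼ w → w ∈ L → x ≢ w → ∃ λ c → x ⋖ c × c ≼ w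
    child-toward (u≼x , _) x≼w w∈L x≢w with ≼-child x≼w x≢w
    ... | c , c≢root , refl , c≼w =
      c , ((up c≢root u≼x , _ , w∈L , c≼w) , (λ { refl → child⋠parent c≢root u≼x }) , refl) , c≼w

    has-child : ∀ {x} → InTree x → ¬ x ∈ L → ∃ (x ⋖_)
    has-child x-in@(_ , w , w∈L , x≼w) x∉L with child-toward x-in x≼w w∈L (∉L⇒≢ x∉L w∈L)
    ... | c , x⋖c , _ = c , x⋖c

    L-childless : ∀ {v c} → v ∈ L → ¬ v ⋖ c
    L-childless v∈L v⋖c@((_ , w , w∈L , c≼w) , _ , refl)
      with L-≼⇒≡ v∈L w∈L (≼-trans (parent≼ (⋖⇒≢root v⋖c)) c≼w)
    ... | refl = child⋠parent (⋖⇒≢root v⋖c) c≼w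

    u∈L⇒alone : u ∈ L → ∀ {x} → InTree x → x ≡ u
    u∈L⇒alone u∈L (u≼x , w , w∈L , x≼w) with L-≼⇒≡ u∈L w∈L (≼-trans u≼x x≼w)
    ... | refl = ≼-antisym x≼w u≼x

    Adjacent : Rel (Fin n) 0ℓ
    Adjacent a b = a ⋖ b ⊎ b ⋖ a

    Adjacent? : ∀ a b → Dec (Adjacent a b)
    Adjacent? a b = a ⋖? b ⊎-dec b ⋖? a

    adjacent-in-tree : ∀ {a b} → Adjacent a b → InTree a × InTree b
    adjacent-in-tree (inj₁ a⋖b@(b-in , _)) = ⋖-source-in-tree a⋖b , b-in
    adjacent-in-tree (inj₂ b⋖a@(a-in , _)) = a-in , ⋖-source-in-tree b⋖a

    tree-graph : Subgraph G
    tree-graph = record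
      { verts    = toSubset InTree?
      ; edge     = λ a b → does (Adjacent? a b)
      ; edgeSym  = λ a b → does-⇔ (mk⇔ swap swap) (Adjacent? a b) (Adjacent? b a)
      ; edgeSub  = λ a b ab → [ ⋖-adj , (λ b⋖a → trans (SimpleGraph.sym G a b) (⋖-adj b⋖a)) ]′
                                (does-true⇒ (Adjacent? a b) ab)
      ; edgeVert = λ a b ab → let a-in , b-in = adjacent-in-tree (does-true⇒ (Adjacent? a b) ab)
                              in ∈-toSubset⁺ InTree? a-in , ∈-toSubset⁺ InTree? b-in
      }

    open Subgraph tree-graph using (edge)
    open Walks tree-graph

    edge⁺ : ∀ {a b} → Adjacent a b → edge a b ≡ true
    edge⁺ {a} {b} = dec-true (Adjacent? a b)

    edge⁻ : ∀ {a b} → edge a b ≡ true → Adjacent a b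
    edge⁻ {a} {b} = does-true⇒ (Adjacent? a b)

    walk-to-u : ∀ {x} → u ≼ x → InTree x → ∃ λ ws → Walk tree-graph x u ws
    walk-to-u self x-in = _ , here (∈-toSubset⁺ InTree? x-in)
    walk-to-u {x} (up x≢root u≼px) x-in with x ≟ u
    ... | yes refl = contradiction u≼px (child⋠parent x≢root)
    ... | no x≢u   = _ , step (edge⁺ (inj₂ px⋖x)) (proj₂ (walk-to-u u≼px (⋖-source-in-tree px⋖x)))
      where
        px⋖x : parent x ⋖ x
        px⋖x = parent-⋖ x-in x≢u

    connected : Connected tree-graph
    connected a b a∈ b∈ = walk-join (proj₂ (walk-from a∈)) (walk-reverse (proj₂ (walk-from b∈)))
      where
        walk-from : ∀ {x} → x ∈ toSubset InTree? → ∃ (Walk tree-graph x u)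
        walk-from x∈ = let x-in = ∈-toSubset⁻ InTree? x∈ in walk-to-u (proj₁ x-in) x-in

    -- A path cannot turn back up after a downward step, since the vertex above is the parent it came from.
    descending : ∀ {a b z ws} → Walk tree-graph b z ws → Unique (a ∷ ws) → a ⋖ b → Linked _⋖_ (a ∷ ws)
    descending (here _)   _               a⋖b = a⋖b ∷ [-]
    descending (step e w) uq@(_ ∷ uq-tail) a⋖b with edge⁻ e
    ... | inj₁ b⋖c = a⋖b ∷ descending w uq-tail b⋖c
    ... | inj₂ c⋖b = contradiction
      (there (subst (_∈ₗ _) (sym (⋖-parent-unique a⋖b c⋖b)) (walk-start∈ w))) (Unique[x∷xs]⇒x∉xs uq)

    descent-rank : ∀ {a b z ws} → Walk tree-graph b z ws → Linked _⋖_ (a ∷ ws) → rank a < rank z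
    descent-rank (here _)   (a⋖b ∷ [-])  = ⋖-rank a⋖b
    descent-rank (step _ w) (a⋖b ∷ rest) = <-trans (⋖-rank a⋖b) (descent-rank w rest)

    no-cycle-closing-upward : ∀ {a z ws} → Walk tree-graph a z ws → Unique ws → 3 ≤ length ws → ¬ z ⋖ a
    no-cycle-closing-upward (here _)          _ (s≤s ())
    no-cycle-closing-upward (step _ (here _)) _ (s≤s (s≤s ()))
    no-cycle-closing-upward (step e (step e′ w)) uq@(_ ∷ uq-tail) _ z⋖a with edge⁻ e
    ... | inj₁ a⋖b = <-asym (descent-rank (step e′ w) (descending (step e′ w) uq a⋖b)) (⋖-rank z⋖a)
    ... | inj₂ b⋖a =
      Unique[x∷xs]⇒x∉xs uq-tail (subst (_∈ₗ _) (sym (⋖-parent-unique b⋖a z⋖a)) (walk-end∈ w))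

    acyclic : ¬ HasCycle tree-graph
    acyclic (a , z , ws , (w , uq) , 3≤len , za) with edge⁻ za
    ... | inj₁ z⋖a = no-cycle-closing-upward w uq 3≤len z⋖a
    ... | inj₂ a⋖z = no-cycle-closing-upward (walk-reverse w) (unique-reverse uq)
                       (subst (3 ≤_) (sym (length-reverse ws)) 3≤len) a⋖z

    steiner-tree : Subtree G
    steiner-tree = record
      { graph  = tree-graph
      ; isTree = record
          { nonempty = u , ∈-toSubset⁺ InTree? u-in-tree ; connected = connected ; acyclic = acyclic }
      }

    descending-from-u : ∀ {ℓ ws} → Walk tree-graph u ℓ ws → Unique ws → Linked _⋖_ ws
    descending-from-u (here _)   _  = [-]
    descending-from-u (step e w) uq with edge⁻ e
    ... | inj₁ u⋖b            = descending w uq u⋖b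
    ... | inj₂ (_ , u≢u , _) = contradiction refl u≢u

    -- The child y₀ of u towards v₀ is not a common ancestor, so some w₁ ∈ L hangs below another child.
    u-branches : ¬ u ∈ L → 2 ≤ degT tree-graph u
    u-branches u∉L with child-toward u-in-tree (u-common v₀ v₀∈L) v₀∈L (∉L⇒≢ u∉L v₀∈L)
    ... | y₀ , u⋖y₀@(_ , _ , py₀≡u) , _ with ¬CommonAncestor⇒∃ L (proj₂ u-lca y₀ (⋖⇒≢root u⋖y₀) py₀≡u)
    ...   | w₁ , w₁∈L , y₀⋠w₁ with child-toward u-in-tree (u-common w₁ w₁∈L) w₁∈L (∉L⇒≢ u∉L w₁∈L)
    ...     | y₁ , u⋖y₁ , y₁≼w₁ = 2≤degT (edge⁺ (inj₁ u⋖y₀)) (edge⁺ (inj₁ u⋖y₁)) λ { refl → y₀⋠w₁ y₁≼w₁ }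

    root-condition : RootCondition steiner-tree u
    root-condition with u ∈? L
    ... | yes u∈L = inj₂ λ x x∈ → u∈L⇒alone u∈L (∈-toSubset⁻ InTree? x∈)
    ... | no  u∉L = inj₁ (u-branches u∉L)

    L⇒leaf : ∀ {v} → v ∈ L → IsLeaf tree-graph v
    L⇒leaf {v} v∈L = ∈-toSubset⁺ InTree? v-in , by-cases (v ≟ u)
      where
        v-in : InTree v
        v-in = u-common v v∈L , v , v∈L , self
        only-parent : ∀ y → edge v y ≡ true → y ≡ parent v
        only-parent y vy with edge⁻ vy
        ... | inj₁ v⋖y = contradiction v⋖y (L-childless v∈L)
        ... | inj₂ (_ , _ , pv≡y) = sym pv≡y
        by-cases : Dec (v ≡ u) → (degT tree-graph v ≡ 1) ⊎ (∀ x → x ∈ toSubset InTree? → x ≡ v)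
        by-cases (yes refl) = inj₂ λ x x∈ → u∈L⇒alone v∈L (∈-toSubset⁻ InTree? x∈)
        by-cases (no v≢u)   = inj₁ (degT≡1 (edge⁺ (inj₂ (parent-⋖ v-in v≢u))) only-parent)

    ∉L⇒2≤degT : ∀ {v} → InTree v → ¬ v ∈ L → 2 ≤ degT tree-graph v
    ∉L⇒2≤degT {v} v-in v∉L = by-cases (v ≟ u)
      where
        by-cases : Dec (v ≡ u) → 2 ≤ degT tree-graph v
        by-cases (yes refl) = u-branches v∉L
        by-cases (no v≢u) with has-child v-in v∉L
        ... | c , v⋖c = 2≤degT (edge⁺ (inj₂ pv⋖v)) (edge⁺ (inj₁ v⋖c)) (⋖-chain-≢ pv⋖v v⋖c)
          where
            pv⋖v : parent v ⋖ v
            pv⋖v = parent-⋖ v-in v≢u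

    leaf⇒L : ∀ {v} → IsLeaf tree-graph v → v ∈ L
    leaf⇒L {v} (v∈ , v-leaf) with v ∈? L
    ... | yes v∈L = v∈L
    ... | no  v∉L =
      contradiction v-leaf [ (λ deg≡1 → <-irrefl (sym deg≡1) (∉L⇒2≤degT v-in v∉L)) , not-alone ]′
      where
        v-in : InTree v
        v-in = ∈-toSubset⁻ InTree? v∈
        not-alone : ¬ (∀ x → x ∈ toSubset InTree? → x ≡ v)
        not-alone alone with has-child v-in v∉L
        ... | c , v⋖c = ⋖-irrefl (subst (v ⋖_) (alone c (∈-toSubset⁺ InTree? (proj₁ v⋖c))) v⋖c)

    directed-subtree : Σ (Subtree G) λ T → Σ (Fin n) λ u → Directed R T u × LeavesEq T L
    directed-subtree = steiner-tree , u ,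
      ( ∈-toSubset⁺ InTree? u-in-tree
      , (λ _ _ _ (w , uq) → Linked.map ⋖⇒R (descending-from-u w uq))
      , root-condition ) ,
      λ _ → leaf⇒L , L⇒leaf

  directed-subtree : (L : Subset n) → Nonempty L → Antichain R L →
                     Σ (Subtree G) λ T → Σ (Fin n) λ u → Directed R T u × LeavesEq T L
  directed-subtree L L≠∅@(_ , v₀∈L) L-antichain =
    SteinerTree.directed-subtree L L-antichain v₀∈L (proj₂ (lowest-common-ancestor L L≠∅))

T-<ᵇ∧ : ∀ {i j b} → T ((i <ᵇ j) ∧ b) → i < j × b ≡ true
T-<ᵇ∧ {i} {j} t = let i<ᵇj , tb = Equivalence.to T-∧ t in <ᵇ⇒< i j i<ᵇj , Equivalence.to T-≡ tb

module _ {n : ℕ} (G : SimpleGraph n) where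

  ⪯-trans : Transitive (_⪯_ G)
  ⪯-trans (single _)    y⪯z = y⪯z
  ⪯-trans (step e lt p) y⪯z = step e lt (⪯-trans p y⪯z)

  forward-edge⇒⪯ : ∀ {x y} → adj G x y ≡ true → toℕ x < toℕ y → _⪯_ G x y
  forward-edge⇒⪯ {y = y} xy x<y = step xy x<y (single y)

  earlier-neighbour : ∀ i → 1 ≤ indeg G i → ∃ λ j → adj G i j ≡ true × toℕ j < toℕ i
  earlier-neighbour i 1≤indeg with filterᵇ-witness _ (allFin n) 1≤indeg
  ... | j , t = let j<i , ij = T-<ᵇ∧ t in j , ij , j<i

  later-neighbour : ∀ i → 1 ≤ outdeg G i → ∃ λ j → adj G i j ≡ true × toℕ i < toℕ j
  later-neighbour i 1≤outdeg with filterᵇ-witness _ (allFin n) 1≤outdeg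
  ... | j , t = let i<j , ij = T-<ᵇ∧ t in j , ij , i<j

penultimate : ∀ {n} {a b y : Fin n} → suc (suc (toℕ a)) ≡ n → suc (toℕ b) ≡ n → y ≢ b →
              n ≤ suc (suc (toℕ y)) → y ≡ a
penultimate {n} {a} {b} {y} 2+a≡n 1+b≡n y≢b n≤2+y =
  toℕ-injective (suc-injective (suc-injective (trans 2+y≡n (sym 2+a≡n))))
  where
    1+y≢n : suc (toℕ y) ≢ n
    1+y≢n 1+y≡n = y≢b (toℕ-injective (suc-injective (trans 1+y≡n (sym 1+b≡n))))
    2+y≡n : suc (suc (toℕ y)) ≡ n
    2+y≡n = ≤-antisym (≤∧≢⇒< (toℕ<n y) 1+y≢n) n≤2+y

forward-subtree : ∀ {n k} (G : SimpleGraph n) → KOrdered G k → (L : Subset n) → Nonempty L → IsAntichain G L →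
                  Σ (Subtree G) λ S → Σ (Fin n) λ u → ForwardDirected S u × LeavesEq S L
forward-subtree {zero}  _ _       _ (() , _)
forward-subtree {suc _} G ordered L =
  Arborescence.directed-subtree G (single _) (⪯-trans G) toℕ zero predecessor L
  where
    predecessor : ∀ y → y ≢ zero → ∃ λ x → adj G y x ≡ true × toℕ x < toℕ y × _⪯_ G x y
    predecessor zero    0≢0 = contradiction refl 0≢0
    predecessor (suc i) _   with earlier-neighbour G (suc i) (KOrdered.indegPos ordered (suc i) (s≤s z≤n))
    ... | x , yx , x<y = x , yx , x<y , forward-edge⇒⪯ G (trans (SimpleGraph.sym G x (suc i)) yx) x<y

backward-subtree : ∀ {n k} (G : SimpleGraph n) → KOrdered G k → (L : Subset n) → Nonempty L → IsAntichain G L →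
                   Σ (Subtree G) λ T → Σ (Fin n) λ w → BackwardDirected T w × LeavesEq T L
backward-subtree {n} G ordered L L≠∅ L-antichain with KOrdered.lastEdge ordered
... | a , b , 2+a≡n , 1+b≡n , ab =
  Arborescence.directed-subtree G (single _) (λ x⪰y y⪰z → ⪯-trans G y⪰z x⪰y) (λ y → n ∸ toℕ y) b predecessor
    L L≠∅ (λ v w v∈L w∈L w⪯v → sym (L-antichain w v w∈L v∈L w⪯v))
  where
    later-unless-last : ∀ y → y ≢ b → ∃ λ x → adj G y x ≡ true × toℕ y < toℕ x
    later-unless-last y y≢b with suc (suc (toℕ y)) <? n
    ... | yes 2+y<n = later-neighbour G y (≤-trans (s≤s z≤n) (proj₁ (KOrdered.outdegBounds ordered y 2+y<n)))
    ... | no  2+y≮n with penultimate 2+a≡n 1+b≡n y≢b (≮⇒≥ 2+y≮n)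
    ...   | refl = b , ab , ≤-reflexive (suc-injective (trans 2+a≡n (sym 1+b≡n)))
    predecessor : ∀ y → y ≢ b → ∃ λ x → adj G y x ≡ true × n ∸ toℕ x < n ∸ toℕ y × _⪯_ G y x
    predecessor y y≢b with later-unless-last y y≢b
    ... | x , yx , y<x = x , yx , ∸-monoʳ-< y<x (<⇒≤ (toℕ<n x)) , forward-edge⇒⪯ G yx y<x

lemma4p5 : ∀ {n : ℕ} (k : ℕ) → 3 ≤ k → (G : SimpleGraph n) → KOrdered G k →
    (L : Subset n) → Nonempty L → IsAntichain G L →
    Σ (Subtree G) λ S → Σ (Fin n) λ u → Σ (Subtree G) λ T → Σ (Fin n) λ w →
      ForwardDirected S u × LeavesEq S L × BackwardDirected T w × LeavesEq T L
lemma4p5 k _ G ordered L L≠∅ L-antichain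
  with forward-subtree G ordered L L≠∅ L-antichain | backward-subtree G ordered L L≠∅ L-antichain
... | S , u , S-forward , S-leaves | T , w , T-backward , T-leaves =
  S , u , T , w , S-forward , S-leaves , T-backward , T-leaves
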